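{- Let $\mathbf{A},\mathbf{B}$ be finite $\sigma$-structures with universes $A,B$. Suppose that (1) for every $a\in A$ there exist a homomorphism $h$ from $\mathbf{A}$ to $\mathbf{B}$ and a homomorphism $g$ from $\mathbf{B}$ to $\mathbf{A}$ with $g(h(a))=a$; and (2) for every $b\in B$ there exist a homomorphism $h$ from $\mathbf{A}$ to $\mathbf{B}$ and a homomorphism $g$ from $\mathbf{B}$ to $\mathbf{A}$ with $h(g(b))=b$. Then for every finite set $\mathcal{V}$ of views over $\sigma$, $\Lambda^{\mathcal{V}}(\mathbf{A})$ and $\Lambda^{\mathcal{V}}(\mathbf{B})$ satisfy the same first-order sentences without equality over the unary vocabulary $\mathcal{V}$ of quantifier rank $1$.
   Context: A view over $\sigma$ is a unary conjunctive query without equality and without negation: $V(y)\equiv\exists x_1,\ldots,x_n\,(R_1(u_1)\wedge\cdots\wedge R_k(u_k))$ with exactly one free variable $y$, $R_i\in\sigma$, $u_i$ tuples of variables. For a $\sigma$-structure $\mathbf{I}$ with universe $I$ and a finite set $\mathcal{V}$ of views, $\Lambda^{\mathcal{V}}(\mathbf{I})$ is the structure over the unary vocabulary $\mathcal{V}$ with universe $I$ in which each $V\in\mathcal{V}$ is interpreted as the set of elements of $\mathbf{I}$ satisfying the view $V$. A homomorphism from $\mathbf{A}$ to $\mathbf{B}$ is a map $h:A\to B$ such that $(h(a_1),\ldots,h(a_r))\in R^{\mathbf{B}}$ whenever $(a_1,\ldots,a_r)\in R^{\mathbf{A}}$, for every $R\in\sigma$. -}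

module Defs where

open import Data.Nat using (ℕ; zero; suc; _⊔_; _≟_)
open import Data.Fin using (Fin)
open import Data.List using (List)
open import Data.List.Relation.Unary.All using (All)
open import Data.List.Relation.Unary.Any using (Any)
open import Data.Product using (Σ; ∃; _×_; _,_; proj₁; proj₂)
open import Data.Sum using (_⊎_)
open import Data.Empty using (⊥)
open import Data.Unit using (⊤)
open import Relation.Nullary using (¬_; yes; no)
open import Relation.Binary.PropositionalEquality using (_≡_)
open import Function using (_∘_)

record Signature : Set where
  field
    nSym  : ℕ
    arity : Fin nSym → ℕ
open Signature public

-- A finite σ-structure. Its universe is Fin (suc size) (finite and
-- nonempty); each symbol R is interpreted as a relation on tuples
-- (a tuple of arity r is a map Fin r → universe).
record Structure (σ : Signature) : Set₁ where
  field
    size : ℕ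
    rel  : (R : Fin (nSym σ)) → (Fin (arity σ R) → Fin (suc size)) → Set
open Structure public

U : ∀ {σ} → Structure σ → Set
U A = Fin (suc (size A))

Hom : ∀ {σ} → Structure σ → Structure σ → Set
Hom {σ} A B =
  Σ (U A → U B) λ h →
    ∀ (R : Fin (nSym σ)) (t : Fin (arity σ R) → U A) → rel A R t → rel B R (h ∘ t)

-- Views: unary conjunctive queries without equality / negation.
-- Variables are Fin (suc m); the variable `zero` is the free variable y,
-- the others x₁..xₘ are existentially quantified.

Atom : Signature → ℕ → Set
Atom σ m = Σ (Fin (nSym σ)) λ R → (Fin (arity σ R) → Fin (suc m))

record View (σ : Signature) : Set where
  field
    m     : ℕ
    atoms : List (Atom σ m)
    -- y really is a free variable: it occurs in some atom
    yOccurs : Any (λ at → ∃ λ j → proj₂ at j ≡ Fin.zero) atoms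
open View public

satView : ∀ {σ} → (A : Structure σ) → View σ → U A → Set
satView A V a =
  Σ (Fin (suc (m V)) → U A) λ ν →
    (ν Fin.zero ≡ a) × All (λ at → rel A (proj₁ at) (ν ∘ proj₂ at)) (atoms V)

record UStructure (p : ℕ) : Set₁ where
  field
    usize : ℕ
    pred  : Fin p → Fin (suc usize) → Set
open UStructure public

Λ : ∀ {σ p} → (Fin p → View σ) → Structure σ → UStructure p
Λ {σ} {p} 𝒱 A = record { usize = size A ; pred = λ i a → satView A (𝒱 i) a }

data Formula (p : ℕ) : Set where
  atom  : Fin p → ℕ → Formula p
  ⊤'    : Formula p
  ⊥'    : Formula p
  ¬'_   : Formula p → Formula p
  _∧'_  : Formula p → Formula p → Formula p
  _∨'_  : Formula p → Formula p → Formula p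
  _⇒'_  : Formula p → Formula p → Formula p
  ∃'    : ℕ → Formula p → Formula p
  ∀'    : ℕ → Formula p → Formula p

qr : ∀ {p} → Formula p → ℕ
qr (atom _ _) = 0
qr ⊤' = 0
qr ⊥' = 0
qr (¬' φ) = qr φ
qr (φ ∧' ψ) = qr φ ⊔ qr ψ
qr (φ ∨' ψ) = qr φ ⊔ qr ψ
qr (φ ⇒' ψ) = qr φ ⊔ qr ψ
qr (∃' _ φ) = suc (qr φ)
qr (∀' _ φ) = suc (qr φ)

data Free {p : ℕ} (x : ℕ) : Formula p → Set where
  f-atom : ∀ i → Free x (atom i x)
  f-¬    : ∀ {φ} → Free x φ → Free x (¬' φ)
  f-∧ˡ   : ∀ {φ ψ} → Free x φ → Free x (φ ∧' ψ)
  f-∧ʳ   : ∀ {φ ψ} → Free x ψ → Free x (φ ∧' ψ)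
  f-∨ˡ   : ∀ {φ ψ} → Free x φ → Free x (φ ∨' ψ)
  f-∨ʳ   : ∀ {φ ψ} → Free x ψ → Free x (φ ∨' ψ)
  f-⇒ˡ   : ∀ {φ ψ} → Free x φ → Free x (φ ⇒' ψ)
  f-⇒ʳ   : ∀ {φ ψ} → Free x ψ → Free x (φ ⇒' ψ)
  f-∃    : ∀ {y φ} → ¬ (x ≡ y) → Free x φ → Free x (∃' y φ)
  f-∀    : ∀ {y φ} → ¬ (x ≡ y) → Free x φ → Free x (∀' y φ)

Sentence : ∀ {p} → Formula p → Set
Sentence φ = ∀ x → ¬ Free x φ

_[_↦_] : {X : Set} → (ℕ → X) → ℕ → X → (ℕ → X)
(ρ [ x ↦ a ]) y with y ≟ x
... | yes _ = a
... | no  _ = ρ y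

Sat : ∀ {p} (M : UStructure p) → (ℕ → Fin (suc (usize M))) → Formula p → Set
Sat M ρ (atom i x) = pred M i (ρ x)
Sat M ρ ⊤' = ⊤
Sat M ρ ⊥' = ⊥
Sat M ρ (¬' φ) = ¬ Sat M ρ φ
Sat M ρ (φ ∧' ψ) = Sat M ρ φ × Sat M ρ ψ
Sat M ρ (φ ∨' ψ) = Sat M ρ φ ⊎ Sat M ρ ψ
Sat M ρ (φ ⇒' ψ) = Sat M ρ φ → Sat M ρ ψ
Sat M ρ (∃' x φ) = Σ (Fin (suc (usize M))) λ a → Sat M (ρ [ x ↦ a ]) φ
Sat M ρ (∀' x φ) = (a : Fin (suc (usize M))) → Sat M (ρ [ x ↦ a ]) φ

-- truth of a sentence (independent of the assignment; universe nonempty)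
_⊨_ : ∀ {p} → UStructure p → Formula p → Set
M ⊨ φ = (ρ : ℕ → Fin (suc (usize M))) → Sat M ρ φ

-- Over a unary vocabulary, formulas without equality cannot tell apart two
-- elements satisfying the same atoms.  So it suffices to relate every element
-- of Λ(A) to some element of Λ(B) and vice versa, with related elements
-- satisfying the same views.  Homomorphisms preserve views, so a ∈ A and h(a)
-- satisfy the same views whenever g(h(a)) = a, and symmetrically for b and g(b)
-- when h(g(b)) = b; hypotheses (1) and (2) provide exactly these pairs.
module Submission where

open import Defs
open import Data.Nat using (ℕ; suc; _≤_; _≟_)
open import Data.Fin using (Fin)
open import Data.Product using (Σ; proj₁; _,_)
open import Data.Product.Function.NonDependent.Propositional using (_×-⇔_)
open import Data.Sum.Function.Propositional using (_⊎-⇔_)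
open import Data.Empty using (⊥-elim)
open import Data.List.Relation.Unary.All as All using ()
open import Relation.Nullary using (¬_; yes; no)
open import Relation.Binary.PropositionalEquality using (_≡_; cong; subst)
open import Function using (_∘_)
open import Function.Bundles using (_⇔_; mk⇔; Equivalence)
open import Function.Construct.Identity using (⇔-id)
open import Function.Construct.Symmetry using (⇔-sym)
open import Function.Related.TypeIsomorphisms using (¬-cong-⇔; →-cong-⇔)

open Equivalence

record Correspondence {p : ℕ} (M N : UStructure p) : Set₁ where
  field
    _∼_    : Fin (suc (usize M)) → Fin (suc (usize N)) → Set
    ∼-pred : ∀ {a b} → a ∼ b → ∀ i → pred M i a ⇔ pred N i b
    forth  : ∀ a → Σ _ λ b → a ∼ b
    back   : ∀ b → Σ _ λ a → a ∼ b

module _ {p : ℕ} {M N : UStructure p} (C : Correspondence M N) where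
  open Correspondence C

  RelatedOn : Formula p → (ℕ → Fin (suc (usize M))) → (ℕ → Fin (suc (usize N))) → Set
  RelatedOn φ ρ τ = ∀ x → Free x φ → ρ x ∼ τ x

  relatedOn-update : ∀ {ρ τ a b} x φ →
    (∀ y → ¬ y ≡ x → Free y φ → ρ y ∼ τ y) → a ∼ b →
    RelatedOn φ (ρ [ x ↦ a ]) (τ [ x ↦ b ])
  relatedOn-update x φ ρ∼τ a∼b y y∈φ with y ≟ x
  ... | yes _   = a∼b
  ... | no  y≢x = ρ∼τ y y≢x y∈φ

  sat-correspondence : ∀ φ {ρ τ} → RelatedOn φ ρ τ → Sat M ρ φ ⇔ Sat N τ φ
  sat-correspondence (atom i x) ρ∼τ = ∼-pred (ρ∼τ x (f-atom i)) i
  sat-correspondence ⊤'         _   = ⇔-id _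
  sat-correspondence ⊥'         _   = ⇔-id _
  sat-correspondence (¬' φ)     ρ∼τ = ¬-cong-⇔ (sat-correspondence φ (λ x → ρ∼τ x ∘ f-¬))
  sat-correspondence (φ ∧' ψ)   ρ∼τ =
    sat-correspondence φ (λ x → ρ∼τ x ∘ f-∧ˡ) ×-⇔ sat-correspondence ψ (λ x → ρ∼τ x ∘ f-∧ʳ)
  sat-correspondence (φ ∨' ψ)   ρ∼τ =
    sat-correspondence φ (λ x → ρ∼τ x ∘ f-∨ˡ) ⊎-⇔ sat-correspondence ψ (λ x → ρ∼τ x ∘ f-∨ʳ)
  sat-correspondence (φ ⇒' ψ)   ρ∼τ =
    →-cong-⇔ (sat-correspondence φ (λ x → ρ∼τ x ∘ f-⇒ˡ)) (sat-correspondence ψ (λ x → ρ∼τ x ∘ f-⇒ʳ))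
  sat-correspondence (∃' x φ) {ρ} {τ} ρ∼τ = mk⇔
    (λ (a , ⊨φ) → let (b , a∼b) = forth a in b , to   (body a∼b) ⊨φ)
    (λ (b , ⊨φ) → let (a , a∼b) = back b  in a , from (body a∼b) ⊨φ)
    where
    body : ∀ {a b} → a ∼ b → Sat M (ρ [ x ↦ a ]) φ ⇔ Sat N (τ [ x ↦ b ]) φ
    body = sat-correspondence φ ∘ relatedOn-update x φ (λ y y≢x → ρ∼τ y ∘ f-∃ y≢x)
  sat-correspondence (∀' x φ) {ρ} {τ} ρ∼τ = mk⇔
    (λ ⊨φ b → let (a , a∼b) = back b  in to   (body a∼b) (⊨φ a))
    (λ ⊨φ a → let (b , a∼b) = forth a in from (body a∼b) (⊨φ b))
    where
    body : ∀ {a b} → a ∼ b → Sat M (ρ [ x ↦ a ]) φ ⇔ Sat N (τ [ x ↦ b ]) φ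
    body = sat-correspondence φ ∘ relatedOn-update x φ (λ y y≢x → ρ∼τ y ∘ f-∀ y≢x)

  sentence-correspondence : ∀ {φ} → Sentence φ → (M ⊨ φ) ⇔ (N ⊨ φ)
  sentence-correspondence {φ} closed = mk⇔
    (λ M⊨φ τ → to   (sat-correspondence φ vacuous) (M⊨φ (λ _ → Fin.zero)))
    (λ N⊨φ ρ → from (sat-correspondence φ vacuous) (N⊨φ (λ _ → Fin.zero)))
    where
    vacuous : ∀ {ρ τ} → RelatedOn φ ρ τ
    vacuous x x∈φ = ⊥-elim (closed x x∈φ)

hom-satView : ∀ {σ} (A B : Structure σ) ((h , h-hom) : Hom A B) (V : View σ) {a} →
  satView A V a → satView B V (h a)
hom-satView A B (h , h-hom) V (ν , ν0≡a , atoms-hold) =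
  h ∘ ν , cong h ν0≡a , All.map (λ {(R , u)} → h-hom R (ν ∘ u)) atoms-hold

SameViews : ∀ {σ p} → (Fin p → View σ) → (A B : Structure σ) → U A → U B → Set
SameViews 𝒱 A B a b = ∀ i → satView A (𝒱 i) a ⇔ satView B (𝒱 i) b

sameViews-retract : ∀ {σ p} (𝒱 : Fin p → View σ) (A B : Structure σ)
  (h : Hom A B) (g : Hom B A) {a} → proj₁ g (proj₁ h a) ≡ a →
  SameViews 𝒱 A B a (proj₁ h a)
sameViews-retract 𝒱 A B h g gha≡a i = mk⇔
  (hom-satView A B h (𝒱 i))
  (subst (satView A (𝒱 i)) gha≡a ∘ hom-satView B A g (𝒱 i))

theorem7p5 : {σ : Signature} (A B : Structure σ)
    → ((a : U A) → Σ (Hom A B) λ h → Σ (Hom B A) λ g → proj₁ g (proj₁ h a) ≡ a)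
    → ((b : U B) → Σ (Hom A B) λ h → Σ (Hom B A) λ g → proj₁ h (proj₁ g b) ≡ b)
    → (p : ℕ) (𝒱 : Fin p → View σ) (φ : Formula p)
    → Sentence φ → qr φ ≤ 1
    → (Λ 𝒱 A ⊨ φ) ⇔ (Λ 𝒱 B ⊨ φ)
theorem7p5 A B retractA retractB p 𝒱 φ closed _ =
  sentence-correspondence correspondence closed
  where
  correspondence : Correspondence (Λ 𝒱 A) (Λ 𝒱 B)
  correspondence = record
    { _∼_    = SameViews 𝒱 A B
    ; ∼-pred = λ same → same
    ; forth  = λ a → let (h , g , gha≡a) = retractA a in
                 proj₁ h a , sameViews-retract 𝒱 A B h g gha≡a
    ; back   = λ b → let (h , g , hgb≡b) = retractB b in
                 proj₁ g b , ⇔-sym ∘ sameViews-retract 𝒱 B A g h hgb≡b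
    }
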